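{- Let $k\ge1$ be an integer and $G$ a finite simple graph. Then $d_R^k(G)=1$ if and only if $k=1$ and $G$ is empty (has no edges).
   Context: A Roman $k$-dominating function (RkDF) on a graph $G$ is a map $f:V(G)\to\{0,1,2\}$ such that every vertex $v$ with $f(v)=0$ has at least $k$ neighbors $u$ with $f(u)=2$. A set $\{f_1,\ldots,f_d\}$ of pairwise distinct RkDFs on $G$ with $\sum_{i=1}^d f_i(v)\le 2k$ for every $v\in V(G)$ is a Roman $(k,k)$-dominating family on $G$; the maximum number of functions in such a family is the Roman $(k,k)$-domatic number $d_R^k(G)$. -}

module Defs where

open import Data.Nat using (ℕ; zero; suc; _+_; _≤_; _≡ᵇ_)
open import Data.Fin using (Fin; zero; suc)
open import Data.Bool using (Bool; true; false; _∧_; if_then_else_)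
open import Data.Product using (Σ; _×_)
open import Relation.Binary.PropositionalEquality using (_≡_; _≢_)
open import Relation.Nullary using (¬_)

record Graph (n : ℕ) : Set where
  field
    adj    : Fin n → Fin n → Bool
    sym    : ∀ u v → adj u v ≡ adj v u
    irrefl : ∀ v → adj v v ≡ false
open Graph public

∑ : (d : ℕ) → (Fin d → ℕ) → ℕ
∑ zero    g = 0
∑ (suc d) g = g zero + ∑ d (λ i → g (suc i))

Edgeless : ∀ {n} → Graph n → Set
Edgeless {n} G = ∀ (u v : Fin n) → adj G u v ≡ false

twoNeighbours : ∀ {n} → Graph n → (Fin n → ℕ) → Fin n → ℕ
twoNeighbours {n} G f v = ∑ n (λ u → if adj G v u ∧ (f u ≡ᵇ 2) then 1 else 0)

IsRkDF : ℕ → ∀ {n} → Graph n → (Fin n → ℕ) → Set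
IsRkDF k {n} G f = (∀ v → f v ≤ 2) × (∀ v → f v ≡ 0 → k ≤ twoNeighbours G f v)

Distinct : ∀ {n} → (Fin n → ℕ) → (Fin n → ℕ) → Set
Distinct {n} f g = ¬ (∀ v → f v ≡ g v)

IsRkkFamily : ℕ → ∀ {n} → Graph n → (d : ℕ) → (Fin d → Fin n → ℕ) → Set
IsRkkFamily k {n} G d F =
  (∀ i → IsRkDF k G (F i)) ×
  (∀ i j → i ≢ j → Distinct (F i) (F j)) ×
  (∀ v → ∑ d (λ i → F i v) ≤ 2 * k)
  where open import Data.Nat using (_*_)

HasRkkFamilyOfSize : ℕ → ∀ {n} → Graph n → ℕ → Set
HasRkkFamilyOfSize k {n} G d = Σ (Fin d → Fin n → ℕ) (IsRkkFamily k G d)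

RomanDomaticNumberIs : ℕ → ∀ {n} → Graph n → ℕ → Set
RomanDomaticNumberIs k G d =
  HasRkkFamilyOfSize k G d × (∀ d' → HasRkkFamilyOfSize k G d' → d' ≤ d)

module Submission where

-- Both directions reduce to the existence or non-existence of a Roman
-- (k,k)-dominating family with two members.
--   * The constant function 2 is always a family of size 1 (`constantTwoFamily`).
--   * If k ≥ 2, the constants 2 and 1 form a family of size 2 (`constantPairFamily`).
--   * If k = 1 and uv is an edge, the two "spikes" (2 at one endpoint, 0 at the
--     other, 1 elsewhere) form a family of size 2 (`edgePairFamily`).
--   * If k = 1 and G is edgeless, every R1DF is positive everywhere, so two
--     members of a family must both be constantly 1 and hence coincide; thus
--     every family has size at most 1 (`edgeless-familySize≤1`).

open import Defs
open import Data.Nat using (ℕ; _≤_)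
open import Data.Product using (_×_)
open import Relation.Binary.PropositionalEquality using (_≡_)
open import Function.Bundles using (_⇔_)

open import Data.Nat using (zero; suc; _+_; _*_; z≤n; s≤s; _≡ᵇ_)
open import Data.Nat.Properties using (≤-trans; ≤-refl; m≤m+n; m≤n+m; +-monoʳ-≤; *-monoʳ-≤; +-identityʳ)
open import Data.Fin using (Fin; zero; suc; _≟_)
open import Data.Bool using (true; false; _∧_; if_then_else_)
open import Data.Product using (_,_)
open import Relation.Binary.PropositionalEquality using (_≢_; refl; trans; subst; cong) renaming (sym to ≡-sym)
open import Relation.Nullary using (¬_; Dec; yes; no)
open import Data.Empty using (⊥-elim)
open import Function.Bundles using (mk⇔)

∑-zero : ∀ d (g : Fin d → ℕ) → (∀ i → g i ≡ 0) → ∑ d g ≡ 0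
∑-zero zero    g allZero = refl
∑-zero (suc d) g allZero
  rewrite allZero zero = ∑-zero d (λ i → g (suc i)) (λ i → allZero (suc i))

term≤∑ : ∀ d (g : Fin d → ℕ) i → g i ≤ ∑ d g
term≤∑ (suc d) g zero    = m≤m+n (g zero) _
term≤∑ (suc d) g (suc i) = ≤-trans (term≤∑ d (λ j → g (suc j)) i) (m≤n+m _ (g zero))

firstTwo≤∑ : ∀ d (g : Fin (suc (suc d)) → ℕ) → g zero + g (suc zero) ≤ ∑ (suc (suc d)) g
firstTwo≤∑ d g = +-monoʳ-≤ (g zero) (m≤m+n (g (suc zero)) _)

neighbourWithTwo : ∀ {n} (G : Graph n) (f : Fin n → ℕ) {v u : Fin n} →
  adj G v u ≡ true → f u ≡ 2 → 1 ≤ twoNeighbours G f v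
neighbourWithTwo {n} G f {v} {u} vu fu≡2 =
  ≤-trans termIsOne (term≤∑ n _ u)
  where
  termIsOne : 1 ≤ (if adj G v u ∧ (f u ≡ᵇ 2) then 1 else 0)
  termIsOne rewrite vu | fu≡2 = ≤-refl

edgeless-noTwoNeighbours : ∀ {n} (G : Graph n) → Edgeless G →
  ∀ f v → twoNeighbours G f v ≡ 0
edgeless-noTwoNeighbours {n} G edgeless f v = ∑-zero n _ termIsZero
  where
  termIsZero : ∀ u → (if adj G v u ∧ (f u ≡ᵇ 2) then 1 else 0) ≡ 0
  termIsZero u rewrite edgeless v u = refl

edgeless-R1DF-positive : ∀ {n} (G : Graph n) → Edgeless G →
  ∀ f → IsRkDF 1 G f → ∀ v → f v ≢ 0
edgeless-R1DF-positive G edgeless f (_ , dominated) v fv≡0 =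
  oneNot≤zero (subst (1 ≤_) (edgeless-noTwoNeighbours G edgeless f v) (dominated v fv≡0))
  where
  oneNot≤zero : ¬ (1 ≤ 0)
  oneNot≤zero ()

-- A constant function with value 1 or 2 is an RkDF for every k: no vertex needs dominating.
constant-isRkDF : ∀ k {n} (G : Graph n) c → 1 ≤ c → c ≤ 2 → IsRkDF k G (λ _ → c)
constant-isRkDF k G (suc c) _ c≤2 = (λ _ → c≤2) , (λ _ ())

constantTwoFamily : ∀ k {n} (G : Graph n) → 1 ≤ k → HasRkkFamilyOfSize k G 1
constantTwoFamily k G 1≤k =
  (λ _ _ → 2) ,
  (λ _ → constant-isRkDF k G 2 (s≤s z≤n) ≤-refl) ,
  (λ { zero zero zero≢zero → ⊥-elim (zero≢zero refl) }) ,
  (λ _ → subst (_≤ 2 * k) (≡-sym (+-identityʳ 2)) (*-monoʳ-≤ 2 1≤k))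

pairFamily : ∀ k {n} (G : Graph n) (f g : Fin n → ℕ) →
  IsRkDF k G f → IsRkDF k G g → Distinct f g →
  (∀ v → f v + g v ≤ 2 * k) → HasRkkFamilyOfSize k G 2
pairFamily k {n} G f g isF isG f≠g bound = F , isRkDF , distinct , sumBound
  where
  F : Fin 2 → Fin n → ℕ
  F zero       = f
  F (suc zero) = g
  isRkDF : ∀ i → IsRkDF k G (F i)
  isRkDF zero       = isF
  isRkDF (suc zero) = isG
  distinct : ∀ i j → i ≢ j → Distinct (F i) (F j)
  distinct zero       zero       i≢j = ⊥-elim (i≢j refl)
  distinct zero       (suc zero) _   = f≠g
  distinct (suc zero) zero       _   = λ g≡f → f≠g (λ v → ≡-sym (g≡f v))
  distinct (suc zero) (suc zero) i≢j = ⊥-elim (i≢j refl)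
  sumBound : ∀ v → ∑ 2 (λ i → F i v) ≤ 2 * k
  sumBound v = subst (_≤ 2 * k) (≡-sym (cong (f v +_) (+-identityʳ (g v)))) (bound v)

constantPairFamily : ∀ k {n} (G : Graph n) → 2 ≤ k → Fin n → HasRkkFamilyOfSize k G 2
constantPairFamily k G 2≤k w =
  pairFamily k G (λ _ → 2) (λ _ → 1)
    (constant-isRkDF k G 2 (s≤s z≤n) ≤-refl)
    (constant-isRkDF k G 1 ≤-refl (s≤s z≤n))
    (λ same → twoIsNotOne (same w))
    (λ _ → ≤-trans (s≤s (s≤s (s≤s z≤n))) (*-monoʳ-≤ 2 2≤k))
  where
  twoIsNotOne : ¬ (2 ≡ 1)
  twoIsNotOne ()

spike : ∀ {n} → Fin n → Fin n → Fin n → ℕ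
spike a b w with w ≟ a
... | yes _ = 2
... | no _ with w ≟ b
...   | yes _ = 0
...   | no _  = 1

spike-source : ∀ {n} (a b : Fin n) → spike a b a ≡ 2
spike-source a b with a ≟ a
... | yes _   = refl
... | no a≢a = ⊥-elim (a≢a refl)

spike-target : ∀ {n} (a b : Fin n) → a ≢ b → spike a b b ≡ 0
spike-target a b a≢b with b ≟ a
... | yes b≡a = ⊥-elim (a≢b (≡-sym b≡a))
... | no _ with b ≟ b
...   | yes _   = refl
...   | no b≢b = ⊥-elim (b≢b refl)

spike-elsewhere : ∀ {n} (a b w : Fin n) → w ≢ a → w ≢ b → spike a b w ≡ 1
spike-elsewhere a b w w≢a w≢b with w ≟ a
... | yes w≡a = ⊥-elim (w≢a w≡a)
... | no _ with w ≟ b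
...   | yes w≡b = ⊥-elim (w≢b w≡b)
...   | no _    = refl

spike≤2 : ∀ {n} (a b w : Fin n) → spike a b w ≤ 2
spike≤2 a b w with w ≟ a
... | yes _ = ≤-refl
... | no _ with w ≟ b
...   | yes _ = z≤n
...   | no _  = s≤s z≤n

spike-zero : ∀ {n} (a b w : Fin n) → spike a b w ≡ 0 → w ≡ b
spike-zero a b w spike≡0 with w ≟ a
spike-zero a b w () | yes _
... | no _ with w ≟ b
...   | yes w≡b = w≡b
spike-zero a b w () | no _ | no _

-- If ab is an edge, spike a b is an R1DF: its zero b is adjacent to a, labelled 2.
spike-isR1DF : ∀ {n} (G : Graph n) (a b : Fin n) → adj G b a ≡ true → a ≢ b →
  IsRkDF 1 G (spike a b)
spike-isR1DF G a b ba a≢b = spike≤2 a b , dominated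
  where
  dominated : ∀ w → spike a b w ≡ 0 → 1 ≤ twoNeighbours G (spike a b) w
  dominated w spike≡0 rewrite spike-zero a b w spike≡0 =
    neighbourWithTwo G (spike a b) ba (spike-source a b)

spikes-sum≤2 : ∀ {n} (u v w : Fin n) → u ≢ v → spike u v w + spike v u w ≤ 2
spikes-sum≤2 u v w u≢v = byCases (w ≟ u) (w ≟ v)
  where
  -- Split on the decisions separately, so that `spike` itself is not abstracted.
  byCases : Dec (w ≡ u) → Dec (w ≡ v) → spike u v w + spike v u w ≤ 2
  byCases (yes refl) (yes w≡v) = ⊥-elim (u≢v w≡v)
  byCases (yes refl) (no _)
    rewrite spike-source u v | spike-target v u (λ v≡u → u≢v (≡-sym v≡u)) = ≤-refl
  byCases (no _)     (yes refl)
    rewrite spike-target u v u≢v | spike-source v u = ≤-refl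
  byCases (no w≢u)   (no w≢v)
    rewrite spike-elsewhere u v w w≢u w≢v | spike-elsewhere v u w w≢v w≢u = ≤-refl

edgePairFamily : ∀ {n} (G : Graph n) (u v : Fin n) → adj G u v ≡ true →
  HasRkkFamilyOfSize 1 G 2
edgePairFamily G u v uv =
  pairFamily 1 G (spike u v) (spike v u)
    (spike-isR1DF G u v (trans (Graph.sym G v u) uv) u≢v)
    (spike-isR1DF G v u uv v≢u)
    (λ same → twoIsNotZero (trans (≡-sym (spike-source u v))
                                  (trans (same u) (spike-target v u v≢u))))
    (λ w → spikes-sum≤2 u v w u≢v)
  where
  u≢v : u ≢ v
  u≢v refl with trans (≡-sym uv) (irrefl G u)
  ... | ()
  v≢u : v ≢ u
  v≢u v≡u = u≢v (≡-sym v≡u)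
  twoIsNotZero : ¬ (2 ≡ 0)
  twoIsNotZero ()

positive-sum≤2-equal : ∀ {a b} → a ≢ 0 → b ≢ 0 → a + b ≤ 2 → a ≡ b
positive-sum≤2-equal {zero}        a≢0 _   _ = ⊥-elim (a≢0 refl)
positive-sum≤2-equal {_} {zero}    _   b≢0 _ = ⊥-elim (b≢0 refl)
positive-sum≤2-equal {suc zero}    {suc zero}    _ _ _ = refl
positive-sum≤2-equal {suc zero}    {suc (suc _)} _ _ (s≤s (s≤s ()))
positive-sum≤2-equal {suc (suc a)} {suc b}       _ _ (s≤s (s≤s a+1+b≤0))
  with ≤-trans (m≤n+m (suc b) a) a+1+b≤0
... | ()

-- In an edgeless graph every Roman (1,1)-dominating family has at most one member:
-- two members would both be constantly 1.
edgeless-familySize≤1 : ∀ {n} (G : Graph n) → Edgeless G →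
  ∀ d → HasRkkFamilyOfSize 1 G d → d ≤ 1
edgeless-familySize≤1 G edgeless zero          _ = z≤n
edgeless-familySize≤1 G edgeless (suc zero)    _ = ≤-refl
edgeless-familySize≤1 G edgeless (suc (suc d)) (F , isRkDF , distinct , sumBound) =
  ⊥-elim (distinct zero (suc zero) (λ ()) firstTwoAgree)
  where
  positive : ∀ i v → F i v ≢ 0
  positive i = edgeless-R1DF-positive G edgeless (F i) (isRkDF i)
  firstTwoAgree : ∀ v → F zero v ≡ F (suc zero) v
  firstTwoAgree v = positive-sum≤2-equal (positive zero v) (positive (suc zero) v)
    (≤-trans (firstTwo≤∑ d (λ i → F i v)) (sumBound v))

twoNot≤one : ¬ (2 ≤ 1)
twoNot≤one (s≤s ())

atMostOne⇒k≡1 : ∀ k {n} (G : Graph n) → 1 ≤ k → Fin n →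
  (∀ d → HasRkkFamilyOfSize k G d → d ≤ 1) → k ≡ 1
atMostOne⇒k≡1 (suc zero)    G _ w _       = refl
atMostOne⇒k≡1 (suc (suc j)) G _ w maximal =
  ⊥-elim (twoNot≤one (maximal 2 (constantPairFamily (suc (suc j)) G (s≤s (s≤s z≤n)) w)))

mainTheorem14 : (k n : ℕ) → 1 ≤ k → 1 ≤ n → (G : Graph n) →
    RomanDomaticNumberIs k G 1 ⇔ (k ≡ 1 × Edgeless G)
mainTheorem14 k (suc m) 1≤k _ G = mk⇔ to from
  where
  to : RomanDomaticNumberIs k G 1 → k ≡ 1 × Edgeless G
  to (_ , maximal) = k≡1 , edgeless
    where
    k≡1 : k ≡ 1
    k≡1 = atMostOne⇒k≡1 k G 1≤k zero maximal
    edgeless : Edgeless G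
    edgeless u v with adj G u v in uv
    ... | false = refl
    ... | true  = ⊥-elim (twoNot≤one (maximal 2
          (subst (λ k → HasRkkFamilyOfSize k G 2) (≡-sym k≡1) (edgePairFamily G u v uv))))
  from : k ≡ 1 × Edgeless G → RomanDomaticNumberIs k G 1
  from (refl , edgeless) = constantTwoFamily 1 G ≤-refl , edgeless-familySize≤1 G edgeless
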